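{- Let $A$ and $B$ be finite sets of UTVPI constraints with integer constants, such that $A\wedge B$ is satisfiable over $\mathbb Q$ but unsatisfiable over $\mathbb Z$. Let $A',B'$ be their difference-logic encodings and let $C$ be a cycle of total weight $0$ in the constraint graph $G(A'\wedge B')$ (each edge labelled as coming from $A'$ or from $B'$; write $C_A$, $C_B$ for the $A'$- and $B'$-edges of $C$) that contains, each exactly once, the two vertices $x_i^+$ and $x_i^-$ of some variable $x_i$, such that the weight of the path from $x_i^-$ to $x_i^+$ along $C$ is odd. Suppose $x_i$ occurs in both $A$ and $B$. Take the maximal $C_A$-paths of $C$, and split each of them at $x_i^+$ and at $x_i^-$ whenever that vertex is an interior vertex of the path (i.e. both its incoming and outgoing edges in $C$ belong to $C_A$), obtaining the two subpaths separated by that vertex. Let $I'$ be the conjunction of the summary constraints of the resulting paths and $I=\Upsilon(I')$. Then $I$ is an interpolant for $(A,B)$ over the integers.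
   Context: A UTVPI constraint is $(0\le a x + b y + k)$ with $a,b\in\{ -1,0,1\}$. For each variable $x$ there are difference-logic variables $x^+,x^-$, with $\Upsilon(x^+)=x$, $\Upsilon(x^-)=-x$; write $v(x)=x^+$, $v(-x)=x^-$ for signed variables. Encoding: $(0\le s_1+s_2+k)$ with $s_1,s_2$ signed occurrences of distinct variables becomes $(0\le v(s_1)-v(-s_2)+k)$ and $(0\le v(s_2)-v(-s_1)+k)$; $(0\le s+k)$ becomes $(0\le v(s)-v(-s)+2k)$. $\Upsilon(0\le v-u+k)=(0\le\Upsilon(v)-\Upsilon(u)+k)$, extended to conjunctions. The graph has an edge $u\xrightarrow{c}v$ per constraint $(0\le v-u+c)$. A maximal $C_A$-path is a maximal path $u_1\xrightarrow{c_1}\cdots\xrightarrow{c_{n-1}}u_n$ of consecutive $C_A$-edges of $C$ preceded and followed in $C$ by $C_B$-edges; the summary constraint of a path $u_1\xrightarrow{c_1}\cdots\xrightarrow{c_{n-1}}u_n$ is $(0\le u_n-u_1+\sum c_j)$. An interpolant for $(A,B)$ over the integers is a formula $I$ with $A\models I$ and $I\wedge B$ unsatisfiable (variables ranging over $\mathbb Z$), and every variable of $I$ occurring in both $A$ and $B$. -}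

module Defs where

open import Data.Nat as ℕ using (ℕ; zero; suc)
open import Data.Nat.DivMod using (_mod_)
open import Data.Fin using (Fin; toℕ)
open import Data.Integer as ℤ using (ℤ; +_)
open import Data.Integer.Divisibility using (_∣_)
open import Data.Rational as ℚ using (ℚ)
open import Data.List using (List; []; _∷_; concatMap)
open import Data.List.Membership.Propositional using (_∈_)
open import Data.List.Relation.Unary.All using (All)
open import Data.List.Relation.Unary.Any using (Any)
open import Data.Product using (_×_; ∃; ∃-syntax; Σ-syntax; _,_)
open import Data.Sum using (_⊎_)
open import Relation.Binary.PropositionalEquality using (_≡_; _≢_)
open import Relation.Nullary using (¬_)

Var : Set
Var = ℕ

data Sign : Set where
  plus minus : Sign

flipSign : Sign → Sign
flipSign plus  = minus
flipSign minus = plus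

record SVar : Set where
  constructor sv
  field
    sign : Sign
    var  : Var
open SVar public

negS : SVar → SVar
negS (sv σ x) = sv (flipSign σ) x

valℤ : (Var → ℤ) → SVar → ℤ
valℤ ρ (sv plus x)  = ρ x
valℤ ρ (sv minus x) = ℤ.- ρ x

valℚ : (Var → ℚ) → SVar → ℚ
valℚ ρ (sv plus x)  = ρ x
valℚ ρ (sv minus x) = ℚ.- ρ x

toℚ : ℤ → ℚ
toℚ k = k ℚ./ 1

-- UTVPI constraints  0 ≤ a x + b y + k,  a,b ∈ {-1,0,1}, integer constant.
-- two s₁ s₂ _ k  :  0 ≤ s₁ + s₂ + k   (s₁, s₂ signed occurrences of distinct variables)
-- one s k        :  0 ≤ s + k

data UTVPI : Set where
  two : (s₁ s₂ : SVar) → var s₁ ≢ var s₂ → ℤ → UTVPI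
  one : SVar → ℤ → UTVPI

satUℤ : (Var → ℤ) → UTVPI → Set
satUℤ ρ (two s₁ s₂ _ k) = + 0 ℤ.≤ (valℤ ρ s₁ ℤ.+ valℤ ρ s₂) ℤ.+ k
satUℤ ρ (one s k)       = + 0 ℤ.≤ valℤ ρ s ℤ.+ k

satUℚ : (Var → ℚ) → UTVPI → Set
satUℚ ρ (two s₁ s₂ _ k) = ℚ.0ℚ ℚ.≤ (valℚ ρ s₁ ℚ.+ valℚ ρ s₂) ℚ.+ toℚ k
satUℚ ρ (one s k)       = ℚ.0ℚ ℚ.≤ valℚ ρ s ℚ.+ toℚ k

SatℚList : List UTVPI → Set
SatℚList Φ = ∃[ ρ ] All (satUℚ ρ) Φ

OccursU : Var → UTVPI → Set
OccursU x (two s₁ s₂ _ _) = var s₁ ≡ x ⊎ var s₂ ≡ x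
OccursU x (one s _)       = var s ≡ x

OccursIn : Var → List UTVPI → Set
OccursIn x Φ = Any (OccursU x) Φ

data DVar : Set where
  _⁺ _⁻ : Var → DVar

vS : SVar → DVar
vS (sv plus x)  = x ⁺
vS (sv minus x) = x ⁻

ΥV : DVar → SVar
ΥV (x ⁺) = sv plus x
ΥV (x ⁻) = sv minus x

-- Difference constraint  0 ≤ to − from + wt ; it is the graph edge  from --wt--> to.
record DC : Set where
  constructor dc
  field
    from : DVar
    to   : DVar
    wt   : ℤ
open DC public

encU : UTVPI → List DC
encU (two s₁ s₂ _ k) = dc (vS (negS s₂)) (vS s₁) k ∷ dc (vS (negS s₁)) (vS s₂) k ∷ []
encU (one s k)       = dc (vS (negS s)) (vS s) (k ℤ.+ k) ∷ []

encode : List UTVPI → List DC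
encode = concatMap encU

record Gen : Set where
  constructor gen
  field
    g₁ g₂ : SVar
    gk    : ℤ
open Gen public

Υ : DC → Gen
Υ (dc u v k) = gen (ΥV v) (negS (ΥV u)) k

satGℤ : (Var → ℤ) → Gen → Set
satGℤ ρ (gen s₁ s₂ k) = + 0 ℤ.≤ (valℤ ρ s₁ ℤ.+ valℤ ρ s₂) ℤ.+ k

OccursG : Var → Gen → Set
OccursG x (gen s₁ s₂ _) = var s₁ ≡ x ⊎ var s₂ ≡ x

-- A (possibly infinite-indexed) conjunction is given by the predicate
-- "g is a conjunct".  Interpolant over the integers:
IsInterpolantℤ : List UTVPI → List UTVPI → (Gen → Set) → Set
IsInterpolantℤ A B I =
    (∀ (ρ : Var → ℤ) → All (satUℤ ρ) A → ∀ g → I g → satGℤ ρ g)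
  × (¬ (∃[ ρ ] ((∀ g → I g → satGℤ ρ g) × All (satUℤ ρ) B)))
  × (∀ g → I g → ∀ x → OccursG x g → OccursIn x A × OccursIn x B)

data Side : Set where
  fromA fromB : Side

LEdge : Set
LEdge = Side × DC

InGraph : List DC → List DC → LEdge → Set
InGraph A' B' (fromA , e) = e ∈ A'
InGraph A' B' (fromB , e) = e ∈ B'

-- A cycle of length (suc n) is given by its edges C 0, …, C n in order;
-- positions are taken cyclically (mod suc n).
module CycleOps {n : ℕ} (C : Fin (suc n) → LEdge) where

  edgeAt : ℕ → LEdge
  edgeAt j = C (j mod suc n)

  sideAt : ℕ → Side
  sideAt j with edgeAt j
  ... | (s , _) = s

  dcAt : ℕ → DC
  dcAt j with edgeAt j
  ... | (_ , e) = e

  srcAt tgtAt : ℕ → DVar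
  srcAt j = from (dcAt j)
  tgtAt j = to (dcAt j)

  wtAt : ℕ → ℤ
  wtAt j = wt (dcAt j)

  pathWeight : ℕ → ℕ → ℤ
  pathWeight i zero    = + 0
  pathWeight i (suc ℓ) = wtAt i ℤ.+ pathWeight (suc i) ℓ

  IsClosedWalk : Set
  IsClosedWalk = ∀ (j : ℕ) → tgtAt j ≡ srcAt (suc j)

  totalWeight : ℤ
  totalWeight = pathWeight 0 (suc n)

  OccursOnceAt : DVar → Fin (suc n) → Set
  OccursOnceAt w p = srcAt (toℕ p) ≡ w × (∀ (j : Fin (suc n)) → srcAt (toℕ j) ≡ w → j ≡ p)

  IsSplit : Var → DVar → Set
  IsSplit x w = w ≡ x ⁺ ⊎ w ≡ x ⁻

  -- The path consisting of the (suc ℓ) edges at positions i, …, i+ℓ is one of the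
  -- paths obtained from the maximal C_A-paths after splitting at x⁺ / x⁻:
  --  * all its edges are C_A-edges,
  --  * it starts after a C_B-edge, or at a split vertex,
  --  * it ends before a C_B-edge, or at a split vertex,
  --  * no interior vertex is a split vertex.
  IsSplitSegment : Var → ℕ → ℕ → Set
  IsSplitSegment x i ℓ =
      (∀ t → t ℕ.≤ ℓ → sideAt (i ℕ.+ t) ≡ fromA)
    × (sideAt (i ℕ.+ n) ≡ fromB ⊎ IsSplit x (srcAt i))
    × (sideAt (i ℕ.+ suc ℓ) ≡ fromB ⊎ IsSplit x (tgtAt (i ℕ.+ ℓ)))
    × (∀ t → 1 ℕ.≤ t → t ℕ.≤ ℓ → ¬ IsSplit x (srcAt (i ℕ.+ t)))

  summary : ℕ → ℕ → DC
  summary i ℓ = dc (srcAt i) (tgtAt (i ℕ.+ ℓ)) (pathWeight i (suc ℓ))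

  Iconj : Var → Gen → Set
  Iconj x g = ∃[ i ] ∃[ ℓ ] (IsSplitSegment x i ℓ × g ≡ Υ (summary i ℓ))

Odd : ℤ → Set
Odd w = ¬ (+ 2 ∣ w)

-- An integer model ρ of I ∧ B would contradict the odd cycle. Cut C at x⁻ and x⁺ into the
-- path from x⁻ to x⁺ (odd weight w) and the path back (weight −w). As x⁻ and x⁺ occur once on C,
-- each path is a concatenation of C_B-edges and of the split C_A-paths, so B′ ∧ I′ entails both
-- x⁺ − x⁻ + w ≥ 0 and x⁻ − x⁺ − w ≥ 0; under Υ, x⁺ − x⁻ is 2x, hence w = −2ρ(x) would be even.
-- Each conjunct of I sums A′-constraints along a C_A-path, so A entails it, and the endpoints of
-- that path are endpoints of B′-edges or x⁺ / x⁻, so its variables are shared.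

module Submission where

open import Defs
open import Data.Nat as ℕ using (ℕ; zero; suc; _≤_; _<_; _+_; _*_; _%_; _/_; z≤n; s≤s; NonZero)
open import Data.Nat.Properties as ℕP using ()
open import Data.Nat.DivMod using (_mod_; m≡m%n+[m/n]*n; m%n%n≡m%n; m%n<n; m<n⇒m%n≡m; [m+n]%n≡m%n)
open import Data.Nat.Divisibility using (∣m+n∣m⇒∣n; n∣m*n; >⇒∤; divides) renaming (_∣_ to _∣ℕ_)
open import Data.Integer.Divisibility using (_∣_)
open import Data.Fin using (Fin; toℕ)
open import Data.Fin.Properties using (toℕ-injective; toℕ-fromℕ<; toℕ<n)
open import Data.Integer as ℤ using (ℤ; +_)
open import Data.Integer.Properties as ℤP using ()
open import Data.Integer.Tactic.RingSolver using (solve-∀)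
open import Data.List using (List; _++_)
open import Data.List.Membership.Propositional using (_∈_)
open import Data.List.Membership.Propositional.Properties using (∈-concatMap⁻)
open import Data.List.Relation.Unary.All as All using (All)
open import Data.List.Relation.Unary.Any as Any using (here; there)
open import Data.Product using (∃-syntax; _×_; _,_; proj₁; proj₂)
open import Data.Sum using (_⊎_; inj₁; inj₂)
import Data.Sum as Sum
open import Function using (id; _$_)
open import Relation.Binary.PropositionalEquality
open import Relation.Nullary using (¬_; contradiction)

valD : (Var → ℤ) → DVar → ℤ
valD ρ u = valℤ ρ (ΥV u)

slack : (Var → ℤ) → DC → ℤ
slack ρ e = (valD ρ (to e) ℤ.- valD ρ (from e)) ℤ.+ wt e

-- A record rather than a synonym, so that e can be inferred from ρ ⊨ e.
record _⊨_ (ρ : Var → ℤ) (e : DC) : Set where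
  constructor mk⊨
  field 0≤slack : + 0 ℤ.≤ slack ρ e

valℤ-negS : ∀ ρ s → valℤ ρ (negS s) ≡ ℤ.- valℤ ρ s
valℤ-negS ρ (sv plus x)  = refl
valℤ-negS ρ (sv minus x) = sym (ℤP.neg-involutive (ρ x))

valD-vS : ∀ ρ s → valD ρ (vS s) ≡ valℤ ρ s
valD-vS ρ (sv plus x)  = refl
valD-vS ρ (sv minus x) = refl

satGℤ-Υ : ∀ ρ e → satGℤ ρ (Υ e) ≡ (+ 0 ℤ.≤ slack ρ e)
satGℤ-Υ ρ (dc u v k) = cong (λ z → + 0 ℤ.≤ (valD ρ v ℤ.+ z) ℤ.+ k) (valℤ-negS ρ (ΥV u))

⊨⇒satΥ : ∀ {ρ e} → ρ ⊨ e → satGℤ ρ (Υ e)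
⊨⇒satΥ {ρ} {e} (mk⊨ h) = subst id (sym (satGℤ-Υ ρ e)) h

satΥ⇒⊨ : ∀ {ρ e} → satGℤ ρ (Υ e) → ρ ⊨ e
satΥ⇒⊨ {ρ} {e} h = mk⊨ (subst id (satGℤ-Υ ρ e) h)

⊨-refl : ∀ ρ u → ρ ⊨ dc u u (+ 0)
⊨-refl ρ u = mk⊨ (ℤP.≤-reflexive (sym (begin
    (a ℤ.- a) ℤ.+ + 0 ≡⟨ ℤP.+-identityʳ (a ℤ.- a) ⟩
    a ℤ.- a           ≡⟨ ℤP.+-inverseʳ a ⟩
    + 0               ∎)))
  where open ≡-Reasoning
        a = valD ρ u

⊨-trans : ∀ {ρ u v w k k′} → ρ ⊨ dc u v k → ρ ⊨ dc v w k′ → ρ ⊨ dc u w (k ℤ.+ k′)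
⊨-trans {ρ} {u} {v} {w} {k} {k′} (mk⊨ uv) (mk⊨ vw) =
  mk⊨ (subst (+ 0 ℤ.≤_) (telescope (valD ρ u) (valD ρ v) (valD ρ w) k k′) (ℤP.+-mono-≤ uv vw))
  where
  telescope : ∀ a b c k k′ → ((b ℤ.- a) ℤ.+ k) ℤ.+ ((c ℤ.- b) ℤ.+ k′) ≡ (c ℤ.- a) ℤ.+ (k ℤ.+ k′)
  telescope = solve-∀

⊨-tight : ∀ {ρ u v k k′} → ρ ⊨ dc u v k → ρ ⊨ dc v u k′ → k ℤ.+ k′ ≡ + 0 → slack ρ (dc u v k) ≡ + 0
⊨-tight {ρ} {u} {v} {k} {k′} (mk⊨ uv) (mk⊨ vu) k+k′≡0 = ℤP.≤-antisym s≤0 uv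
  where
  open ℤP.≤-Reasoning
  s = slack ρ (dc u v k)
  t = slack ρ (dc v u k′)
  slacks-cancel : ∀ a b k k′ → ((b ℤ.- a) ℤ.+ k) ℤ.+ ((a ℤ.- b) ℤ.+ k′) ≡ k ℤ.+ k′
  slacks-cancel = solve-∀
  s≤0 : s ℤ.≤ + 0
  s≤0 = begin
    s           ≡⟨ ℤP.+-identityʳ s ⟨
    s ℤ.+ + 0   ≤⟨ ℤP.+-monoʳ-≤ s vu ⟩
    s ℤ.+ t     ≡⟨ slacks-cancel (valD ρ u) (valD ρ v) k k′ ⟩
    k ℤ.+ k′    ≡⟨ k+k′≡0 ⟩
    + 0         ∎

tight-x⁻→x⁺⇒even : ∀ ρ x w → slack ρ (dc (x ⁻) (x ⁺) w) ≡ + 0 → + 2 ∣ w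
tight-x⁻→x⁺⇒even ρ x w eq = divides ℤ.∣ ℤ.- a ∣ (begin
    ℤ.∣ w ∣                    ≡⟨ cong ℤ.∣_∣ w≡-a*2 ⟩
    ℤ.∣ ℤ.- a ℤ.* + 2 ∣        ≡⟨ ℤP.abs-* (ℤ.- a) (+ 2) ⟩
    ℤ.∣ ℤ.- a ∣ ℕ.* 2          ∎)
  where
  open ≡-Reasoning
  a : ℤ
  a = ρ x
  rearrange : ∀ a w → w ≡ ((a ℤ.- ℤ.- a) ℤ.+ w) ℤ.+ ℤ.- a ℤ.* + 2
  rearrange = solve-∀
  w≡-a*2 : w ≡ ℤ.- a ℤ.* + 2
  w≡-a*2 = begin
    w                                        ≡⟨ rearrange a w ⟩
    ((a ℤ.- ℤ.- a) ℤ.+ w) ℤ.+ ℤ.- a ℤ.* + 2  ≡⟨ cong (ℤ._+ ℤ.- a ℤ.* + 2) eq ⟩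
    + 0 ℤ.+ ℤ.- a ℤ.* + 2                    ≡⟨ ℤP.+-identityˡ _ ⟩
    ℤ.- a ℤ.* + 2                            ∎

valD-vS-difference : ∀ ρ s t → valD ρ (vS s) ℤ.- valD ρ (vS (negS t)) ≡ valℤ ρ s ℤ.+ valℤ ρ t
valD-vS-difference ρ s t = begin
  valD ρ (vS s) ℤ.- valD ρ (vS (negS t))   ≡⟨ cong₂ ℤ._-_ (valD-vS ρ s) (valD-vS ρ (negS t)) ⟩
  valℤ ρ s ℤ.- valℤ ρ (negS t)             ≡⟨ cong (λ z → valℤ ρ s ℤ.- z) (valℤ-negS ρ t) ⟩
  valℤ ρ s ℤ.- ℤ.- valℤ ρ t                ≡⟨ cong (λ z → valℤ ρ s ℤ.+ z) (ℤP.neg-involutive (valℤ ρ t)) ⟩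
  valℤ ρ s ℤ.+ valℤ ρ t                    ∎
  where open ≡-Reasoning

encU-sound : ∀ {ρ c e} → satUℤ ρ c → e ∈ encU c → ρ ⊨ e
encU-sound {ρ} {two s₁ s₂ _ k} sat (here refl) = mk⊨ $
  subst (λ z → + 0 ℤ.≤ z ℤ.+ k) (sym (valD-vS-difference ρ s₁ s₂)) sat
encU-sound {ρ} {two s₁ s₂ _ k} sat (there (here refl)) = mk⊨ $
  subst (λ z → + 0 ℤ.≤ z ℤ.+ k)
        (trans (ℤP.+-comm (valℤ ρ s₁) (valℤ ρ s₂)) (sym (valD-vS-difference ρ s₂ s₁))) sat
encU-sound {ρ} {one s k} sat (here refl) = mk⊨ $
  subst (+ 0 ℤ.≤_)
        (trans (double (valℤ ρ s) k) (cong (ℤ._+ (k ℤ.+ k)) (sym (valD-vS-difference ρ s s))))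
        (ℤP.+-mono-≤ sat sat)
  where
  double : ∀ a k → (a ℤ.+ k) ℤ.+ (a ℤ.+ k) ≡ (a ℤ.+ a) ℤ.+ (k ℤ.+ k)
  double = solve-∀

encode-sound : ∀ {ρ Φ e} → All (satUℤ ρ) Φ → e ∈ encode Φ → ρ ⊨ e
encode-sound sat e∈ = All.lookupWith encU-sound sat (∈-concatMap⁻ encU e∈)

dvar : DVar → Var
dvar u = var (ΥV u)

var≡dvar-vS : ∀ s → var s ≡ dvar (vS s)
var≡dvar-vS (sv plus x)  = refl
var≡dvar-vS (sv minus x) = refl

encU-occurs : ∀ {c e} → e ∈ encU c → OccursU (dvar (from e)) c × OccursU (dvar (to e)) c
encU-occurs {two s₁ s₂ _ _} (here refl)         = inj₂ (var≡dvar-vS (negS s₂)) , inj₁ (var≡dvar-vS s₁)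
encU-occurs {two s₁ s₂ _ _} (there (here refl)) = inj₁ (var≡dvar-vS (negS s₁)) , inj₂ (var≡dvar-vS s₂)
encU-occurs {one s _}       (here refl)         = var≡dvar-vS (negS s) , var≡dvar-vS s

encode-occurs : ∀ {Φ e} → e ∈ encode Φ → OccursIn (dvar (from e)) Φ × OccursIn (dvar (to e)) Φ
encode-occurs e∈ = let e∈c = ∈-concatMap⁻ encU e∈ in
  Any.map (λ m → proj₁ (encU-occurs m)) e∈c , Any.map (λ m → proj₂ (encU-occurs m)) e∈c

%-cancel-shift : ∀ j {d m} .{{_ : NonZero m}} → d < m → j % m ≡ (j + d) % m → d ≡ 0
%-cancel-shift j {zero}  _   _  = refl
%-cancel-shift j {d@(suc _)} {m} d<m eq = contradiction m∣d (>⇒∤ d<m)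
  where
  open ≡-Reasoning
  quotients : j % m + (j / m * m + d) ≡ j % m + (j + d) / m * m
  quotients = begin
    j % m + (j / m * m + d)     ≡⟨ ℕP.+-assoc (j % m) _ d ⟨
    j % m + j / m * m + d       ≡⟨ cong (_+ d) (m≡m%n+[m/n]*n j m) ⟨
    j + d                       ≡⟨ m≡m%n+[m/n]*n (j + d) m ⟩
    (j + d) % m + (j + d) / m * m ≡⟨ cong (_+ (j + d) / m * m) eq ⟨
    j % m + (j + d) / m * m     ∎
  m∣d : m ∣ℕ d
  m∣d = ∣m+n∣m⇒∣n (divides ((j + d) / m) (ℕP.+-cancelˡ-≡ (j % m) _ _ quotients)) (n∣m*n (j / m))

%-injective-ordered : ∀ {j k m} .{{_ : NonZero m}} → j ≤ k → k < j + m → j % m ≡ k % m → j ≡ k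
%-injective-ordered {j} j≤k k<j+m eq with ℕP.m≤n⇒∃[o]m+o≡n j≤k
... | d , refl = sym (trans (cong (λ d → j + d) d≡0) (ℕP.+-identityʳ j))
  where d≡0 : d ≡ 0
        d≡0 = %-cancel-shift j (ℕP.+-cancelˡ-< j _ _ k<j+m) eq

%-injective-on-window : ∀ {b j k m} .{{_ : NonZero m}} →
                        b ≤ j → j < b + m → b ≤ k → k < b + m → j % m ≡ k % m → j ≡ k
%-injective-on-window {b} {j} {k} {m} b≤j j<b+m b≤k k<b+m eq with ℕP.≤-total j k
... | inj₁ j≤k = %-injective-ordered j≤k (ℕP.<-≤-trans k<b+m (ℕP.+-monoˡ-≤ m b≤j)) eq
... | inj₂ k≤j = sym (%-injective-ordered k≤j (ℕP.<-≤-trans j<b+m (ℕP.+-monoˡ-≤ m b≤k)) (sym eq))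

mod-cong : ∀ {m} .{{_ : NonZero m}} j k → j % m ≡ k % m → j mod m ≡ k mod m
mod-cong {m} j k eq =
  toℕ-injective (trans (toℕ-fromℕ< (m%n<n j m)) (trans eq (sym (toℕ-fromℕ< (m%n<n k m)))))

Shared : List UTVPI → List UTVPI → Var → Set
Shared A B y = OccursIn y A × OccursIn y B

module ClosedWalk {n : ℕ} (C : Fin (suc n) → LEdge) (closed : CycleOps.IsClosedWalk C) where
  open CycleOps C

  edgeAt-cong : ∀ j k → j % suc n ≡ k % suc n → edgeAt j ≡ edgeAt k
  edgeAt-cong j k eq = cong C (mod-cong j k eq)

  edgeAt-periodic : ∀ j → edgeAt (suc j + n) ≡ edgeAt j
  edgeAt-periodic j =
    edgeAt-cong (suc j + n) j (trans (cong (_% suc n) (sym (ℕP.+-suc j n))) ([m+n]%n≡m%n j (suc n)))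

  srcAt-mod : ∀ j → srcAt (toℕ (j mod suc n)) ≡ srcAt j
  srcAt-mod j = cong (λ c → from (proj₂ c))
    (edgeAt-cong (toℕ (j mod suc n)) j
      (trans (cong (_% suc n) (toℕ-fromℕ< (m%n<n j (suc n)))) (m%n%n≡m%n j (suc n))))

  tgtAt≡srcAt-next : ∀ s l → tgtAt (s + l) ≡ srcAt (s + suc l)
  tgtAt≡srcAt-next s l = trans (closed (s + l)) (cong srcAt (sym (ℕP.+-suc s l)))

  srcAt-periodic : ∀ j → srcAt (suc j + n) ≡ srcAt j
  srcAt-periodic j = cong (λ c → from (proj₂ c)) (edgeAt-periodic j)

  sideAt-periodic : ∀ j → sideAt (suc j + n) ≡ sideAt j
  sideAt-periodic j = cong proj₁ (edgeAt-periodic j)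

  tgtAt-pred : ∀ j → tgtAt (j + n) ≡ srcAt j
  tgtAt-pred j = trans (closed (j + n)) (srcAt-periodic j)

  occursOnceAt-% : ∀ {w q} j → OccursOnceAt w q → srcAt j ≡ w → j % suc n ≡ toℕ q
  occursOnceAt-% j (_ , unique) srcj≡w =
    trans (sym (toℕ-fromℕ< _)) (cong toℕ (unique (j mod suc n) (trans (srcAt-mod j) srcj≡w)))

  pathWeight-+ : ∀ i a b → pathWeight i (a + b) ≡ pathWeight i a ℤ.+ pathWeight (i + a) b
  pathWeight-+ i zero b =
    sym (trans (ℤP.+-identityˡ _) (cong (λ j → pathWeight j b) (ℕP.+-identityʳ i)))
  pathWeight-+ i (suc a) b = begin
    wtAt i ℤ.+ pathWeight (suc i) (a + b)
      ≡⟨ cong (λ w → wtAt i ℤ.+ w) (pathWeight-+ (suc i) a b) ⟩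
    wtAt i ℤ.+ (pathWeight (suc i) a ℤ.+ pathWeight (suc i + a) b)
      ≡⟨ ℤP.+-assoc (wtAt i) _ _ ⟨
    pathWeight i (suc a) ℤ.+ pathWeight (suc i + a) b
      ≡⟨ cong (λ j → pathWeight i (suc a) ℤ.+ pathWeight j b) (ℕP.+-suc i a) ⟨
    pathWeight i (suc a) ℤ.+ pathWeight (i + suc a) b
      ∎
    where open ≡-Reasoning

  pathWeight-shift : ∀ i → pathWeight (suc i) (suc n) ≡ pathWeight i (suc n)
  pathWeight-shift i = begin
    pathWeight (suc i) (suc n)
      ≡⟨ cong (pathWeight (suc i)) (ℕP.+-comm 1 n) ⟩
    pathWeight (suc i) (n + 1)
      ≡⟨ pathWeight-+ (suc i) n 1 ⟩
    pathWeight (suc i) n ℤ.+ (wtAt (suc i + n) ℤ.+ + 0)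
      ≡⟨ cong (λ w → pathWeight (suc i) n ℤ.+ w) (ℤP.+-identityʳ _) ⟩
    pathWeight (suc i) n ℤ.+ wtAt (suc i + n)
      ≡⟨ cong (λ c → pathWeight (suc i) n ℤ.+ wt (proj₂ c)) (edgeAt-periodic i) ⟩
    pathWeight (suc i) n ℤ.+ wtAt i
      ≡⟨ ℤP.+-comm _ (wtAt i) ⟩
    pathWeight i (suc n)
      ∎
    where open ≡-Reasoning

  pathWeight-rotate : ∀ i → pathWeight i (suc n) ≡ totalWeight
  pathWeight-rotate zero    = refl
  pathWeight-rotate (suc i) = trans (pathWeight-shift i) (pathWeight-rotate i)

  span : ℕ → ℕ → DC
  span s r = dc (srcAt s) (srcAt (s + r)) (pathWeight s r)

  summary≡span : ∀ s l → summary s l ≡ span s (suc l)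
  summary≡span s l = cong (λ v → dc (srcAt s) v (pathWeight s (suc l))) (tgtAt≡srcAt-next s l)

  module _ {ρ : Var → ℤ} where

    span-zero : ∀ s → ρ ⊨ span s 0
    span-zero s = subst (λ j → ρ ⊨ dc (srcAt s) (srcAt j) (+ 0)) (sym (ℕP.+-identityʳ s)) (⊨-refl ρ (srcAt s))

    span-∷ : ∀ j r → ρ ⊨ dcAt j → ρ ⊨ span (suc j) r → ρ ⊨ span j (suc r)
    span-∷ j r edge rest =
      subst (λ i → ρ ⊨ dc (srcAt j) (srcAt i) (pathWeight j (suc r))) (sym (ℕP.+-suc j r))
        (⊨-trans edge
          (subst (λ u → ρ ⊨ dc u (srcAt (suc j + r)) (pathWeight (suc j) r)) (sym (closed j)) rest))

    span-++ : ∀ s a b → ρ ⊨ span s a → ρ ⊨ span (s + a) b → ρ ⊨ span s (a + b)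
    span-++ s a b first second =
      subst₂ (λ i w → ρ ⊨ dc (srcAt s) (srcAt i) w) (ℕP.+-assoc s a b) (sym (pathWeight-+ s a b))
        (⊨-trans first second)

    span-edges : ∀ s r → (∀ t → t < r → ρ ⊨ dcAt (s + t)) → ρ ⊨ span s r
    span-edges s zero    _     = span-zero s
    span-edges s (suc r) edges =
      span-∷ s r (subst (λ i → ρ ⊨ dcAt i) (ℕP.+-identityʳ s) (edges 0 (s≤s z≤n)))
        (span-edges (suc s) r (λ t t<r → subst (λ i → ρ ⊨ dcAt i) (ℕP.+-suc s t) (edges (suc t) (s≤s t<r))))

  Unsplit : Var → ℕ → ℕ → Set
  Unsplit x i j = ∀ t → i < t → t < j → ¬ IsSplit x (srcAt t)

  Unsplit-mono : ∀ {x i i′ j j′} → i ≤ i′ → j′ ≤ j → Unsplit x i j → Unsplit x i′ j′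
  Unsplit-mono i≤i′ j′≤j free t i′<t t<j′ = free t (ℕP.≤-<-trans i≤i′ i′<t) (ℕP.<-≤-trans t<j′ j′≤j)

  StartsRun : Var → ℕ → Set
  StartsRun x s = sideAt (s + n) ≡ fromB ⊎ IsSplit x (srcAt s)

  EndsRun : Var → ℕ → Set
  EndsRun x j = sideAt j ≡ fromB ⊎ IsSplit x (srcAt j)

  AllA : ℕ → ℕ → Set
  AllA s k = ∀ t → t < k → sideAt (s + t) ≡ fromA

  module _ {ρ : Var → ℤ} {x : Var}
    (B-edge  : ∀ j → sideAt j ≡ fromB → ρ ⊨ dcAt j)
    (segment : ∀ s l → IsSplitSegment x s l → ρ ⊨ span s (suc l))
    where

    close-run : ∀ s k → StartsRun x s → AllA s k → Unsplit x s (s + k) → EndsRun x (s + k) → ρ ⊨ span s k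
    close-run s zero    _     _   _    _   = span-zero s
    close-run s (suc l) start run free end = segment s l (run-A , start , end′ , interior)
      where
      run-A : ∀ t → t ≤ l → sideAt (s + t) ≡ fromA
      run-A t t≤l = run t (s≤s t≤l)
      end′ : sideAt (s + suc l) ≡ fromB ⊎ IsSplit x (tgtAt (s + l))
      end′ = Sum.map₂ (subst (IsSplit x) (sym (tgtAt≡srcAt-next s l))) end
      interior : ∀ t → 1 ≤ t → t ≤ l → ¬ IsSplit x (srcAt (s + t))
      interior t 1≤t t≤l = free (s + t) (ℕP.m<m+n s 1≤t) (ℕP.+-monoʳ-< s (s≤s t≤l))

    -- k A-edges starting at s are pending, r edges remain before the split vertex at e.
    decompose : ∀ {e} → IsSplit x (srcAt e) → ∀ s k r → s + (k + r) ≡ e →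
                StartsRun x s → AllA s k → Unsplit x s e → ρ ⊨ span s (k + r)
    decompose {e} split-e s k zero s+k+0≡e start run free =
      subst (λ d → ρ ⊨ span s d) (sym (ℕP.+-identityʳ k))
        (close-run s k start run (Unsplit-mono ℕP.≤-refl (ℕP.≤-reflexive s+k≡e) free)
          (inj₂ (subst (λ j → IsSplit x (srcAt j)) (sym s+k≡e) split-e)))
      where s+k≡e : s + k ≡ e
            s+k≡e = trans (cong (λ d → s + d) (sym (ℕP.+-identityʳ k))) s+k+0≡e
    decompose {e} split-e s k (suc r) eq start run free with sideAt (s + k) in side
    ... | fromA =
      subst (λ d → ρ ⊨ span s d) (sym (ℕP.+-suc k r))
        (decompose split-e s (suc k) r (trans (cong (λ d → s + d) (sym (ℕP.+-suc k r))) eq) start run′ free)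
      where
      run′ : AllA s (suc k)
      run′ t t<1+k with ℕP.m<1+n⇒m<n∨m≡n t<1+k
      ... | inj₁ t<k  = run t t<k
      ... | inj₂ refl = side
    ... | fromB =
      span-++ s k (suc r)
        (close-run s k start run (Unsplit-mono ℕP.≤-refl s+k≤e free) (inj₁ side))
        (span-∷ (s + k) r (B-edge (s + k) side)
          (decompose split-e (suc (s + k)) 0 r eq′ (inj₁ (trans (sideAt-periodic (s + k)) side))
             (λ _ ()) (Unsplit-mono (ℕP.≤-trans (ℕP.m≤m+n s k) (ℕP.n≤1+n _)) ℕP.≤-refl free)))
      where
      s+k+[1+r]≡e : s + k + suc r ≡ e
      s+k+[1+r]≡e = trans (ℕP.+-assoc s k (suc r)) eq
      s+k≤e : s + k ≤ e
      s+k≤e = subst (s + k ≤_) s+k+[1+r]≡e (ℕP.m≤m+n (s + k) (suc r))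
      eq′ : suc (s + k) + r ≡ e
      eq′ = trans (sym (ℕP.+-suc (s + k) r)) s+k+[1+r]≡e

    split-to-split : ∀ s r → IsSplit x (srcAt s) → IsSplit x (srcAt (s + r)) → Unsplit x s (s + r) →
                     ρ ⊨ span s r
    split-to-split s r split-s split-e = decompose split-e s 0 r refl (inj₂ split-s) (λ _ ())

    x⁻→x⁺-weight-even : totalWeight ≡ + 0 → ∀ p ℓ → ℓ ≤ n →
                        OccursOnceAt (x ⁻) p → OccursOnceAt (x ⁺) ((toℕ p + ℓ) mod suc n) →
                        + 2 ∣ pathWeight (toℕ p) ℓ
    x⁻→x⁺-weight-even total≡0 p ℓ ℓ≤n occ⁻ occ⁺ with ℕP.m≤n⇒∃[o]m+o≡n (ℕP.m≤n⇒m≤1+n ℓ≤n)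
    ... | r , ℓ+r≡1+n = tight-x⁻→x⁺⇒even ρ x (pathWeight q ℓ) (⊨-tight x⁻→x⁺ x⁺→x⁻ weights)
      where
      q : ℕ
      q = toℕ p
      q+ℓ+r≡q+1+n : q + ℓ + r ≡ q + suc n
      q+ℓ+r≡q+1+n = trans (ℕP.+-assoc q ℓ r) (cong (λ d → q + d) ℓ+r≡1+n)
      q+ℓ<q+1+n : q + ℓ < q + suc n
      q+ℓ<q+1+n = ℕP.+-monoʳ-< q (s≤s ℓ≤n)

      src-q : srcAt q ≡ x ⁻
      src-q = proj₁ occ⁻
      src-q+ℓ : srcAt (q + ℓ) ≡ x ⁺
      src-q+ℓ = trans (sym (srcAt-mod (q + ℓ))) (proj₁ occ⁺)
      src-q+ℓ+r : srcAt (q + ℓ + r) ≡ x ⁻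
      src-q+ℓ+r = begin
        srcAt (q + ℓ + r)   ≡⟨ cong srcAt (trans q+ℓ+r≡q+1+n (ℕP.+-suc q n)) ⟩
        srcAt (suc q + n)   ≡⟨ srcAt-periodic q ⟩
        srcAt q             ≡⟨ src-q ⟩
        x ⁻                 ∎
        where open ≡-Reasoning

      -- One turn of the cycle from q meets each of x⁻, x⁺ once, at q and q + ℓ.
      only-split : ∀ j → q < j → j < q + suc n → j ≢ q + ℓ → ¬ IsSplit x (srcAt j)
      only-split j q<j j<q+1+n j≢q+ℓ (inj₁ src-j) = j≢q+ℓ $
        %-injective-on-window (ℕP.<⇒≤ q<j) j<q+1+n (ℕP.m≤m+n q ℓ) q+ℓ<q+1+n
          (trans (occursOnceAt-% j occ⁺ src-j) (toℕ-fromℕ< (m%n<n (q + ℓ) (suc n))))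
      only-split j q<j j<q+1+n _ (inj₂ src-j) = ℕP.<⇒≢ q<j $ sym $
        %-injective-on-window (ℕP.<⇒≤ q<j) j<q+1+n ℕP.≤-refl (ℕP.m<m+n q (s≤s z≤n))
          (trans (occursOnceAt-% j occ⁻ src-j) (sym (m<n⇒m%n≡m (toℕ<n p))))

      x⁻→x⁺ : ρ ⊨ dc (x ⁻) (x ⁺) (pathWeight q ℓ)
      x⁻→x⁺ = subst₂ (λ u v → ρ ⊨ dc u v (pathWeight q ℓ)) src-q src-q+ℓ
        (split-to-split q ℓ (inj₂ src-q) (inj₁ src-q+ℓ)
          (λ j q<j j<q+ℓ → only-split j q<j (ℕP.<-trans j<q+ℓ q+ℓ<q+1+n) (ℕP.<⇒≢ j<q+ℓ)))

      x⁺→x⁻ : ρ ⊨ dc (x ⁺) (x ⁻) (pathWeight (q + ℓ) r)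
      x⁺→x⁻ = subst₂ (λ u v → ρ ⊨ dc u v (pathWeight (q + ℓ) r)) src-q+ℓ src-q+ℓ+r
        (split-to-split (q + ℓ) r (inj₁ src-q+ℓ) (inj₂ src-q+ℓ+r)
          (λ j q+ℓ<j j<q+ℓ+r → only-split j (ℕP.≤-<-trans (ℕP.m≤m+n q ℓ) q+ℓ<j)
             (subst (j <_) q+ℓ+r≡q+1+n j<q+ℓ+r) (ℕP.>⇒≢ q+ℓ<j)))

      weights : pathWeight q ℓ ℤ.+ pathWeight (q + ℓ) r ≡ + 0
      weights = begin
        pathWeight q ℓ ℤ.+ pathWeight (q + ℓ) r   ≡⟨ pathWeight-+ q ℓ r ⟨
        pathWeight q (ℓ + r)                      ≡⟨ cong (pathWeight q) ℓ+r≡1+n ⟩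
        pathWeight q (suc n)                      ≡⟨ pathWeight-rotate q ⟩
        totalWeight                               ≡⟨ total≡0 ⟩
        + 0                                       ∎
        where open ≡-Reasoning

inGraph-A : ∀ {A′ B′} c → InGraph A′ B′ c → proj₁ c ≡ fromA → proj₂ c ∈ A′
inGraph-A (fromA , _) e∈A′ refl = e∈A′

inGraph-B : ∀ {A′ B′} c → InGraph A′ B′ c → proj₁ c ≡ fromB → proj₂ c ∈ B′
inGraph-B (fromB , _) e∈B′ refl = e∈B′

module Interpolation (A B : List UTVPI) {n : ℕ} (C : Fin (suc n) → LEdge)
  (in-graph : ∀ j → InGraph (encode A) (encode B) (C j))
  (closed : CycleOps.IsClosedWalk C) (x : Var) where
  open CycleOps C
  open ClosedWalk C closed

  A-edge : ∀ j → sideAt j ≡ fromA → dcAt j ∈ encode A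
  A-edge j = inGraph-A (edgeAt j) (in-graph (j mod suc n))

  B-edge : ∀ j → sideAt j ≡ fromB → dcAt j ∈ encode B
  B-edge j = inGraph-B (edgeAt j) (in-graph (j mod suc n))

  summary-sound : ∀ {ρ} s l → ρ ⊨ span s (suc l) → satGℤ ρ (Υ (summary s l))
  summary-sound {ρ} s l h = ⊨⇒satΥ (subst (ρ ⊨_) (sym (summary≡span s l)) h)

  summary-complete : ∀ {ρ} s l → satGℤ ρ (Υ (summary s l)) → ρ ⊨ span s (suc l)
  summary-complete {ρ} s l h = subst (ρ ⊨_) (summary≡span s l) (satΥ⇒⊨ h)

  implied-by-A : ∀ ρ → All (satUℤ ρ) A → ∀ g → Iconj x g → satGℤ ρ g
  implied-by-A ρ sat-A _ (s , l , (run , _) , refl) = summary-sound s l $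
    span-edges s (suc l) (λ t t≤l → encode-sound sat-A (A-edge (s + t) (run t (ℕP.≤-pred t≤l))))

  inconsistent-with-B : totalWeight ≡ + 0 → ∀ p ℓ → ℓ ≤ n →
                        OccursOnceAt (x ⁻) p → OccursOnceAt (x ⁺) ((toℕ p + ℓ) mod suc n) →
                        Odd (pathWeight (toℕ p) ℓ) →
                        ¬ (∃[ ρ ] ((∀ g → Iconj x g → satGℤ ρ g) × All (satUℤ ρ) B))
  inconsistent-with-B total≡0 p ℓ ℓ≤n occ⁻ occ⁺ odd (ρ , sat-I , sat-B) =
    odd (x⁻→x⁺-weight-even B-sound I-sound total≡0 p ℓ ℓ≤n occ⁻ occ⁺)
    where
    B-sound : ∀ j → sideAt j ≡ fromB → ρ ⊨ dcAt j
    B-sound j side = encode-sound sat-B (B-edge j side)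
    I-sound : ∀ s l → IsSplitSegment x s l → ρ ⊨ span s (suc l)
    I-sound s l seg = summary-complete s l (sat-I _ (s , l , seg , refl))

  module _ (x-in-B : OccursIn x B) where

    split-in-B : ∀ {w} → IsSplit x w → OccursIn (dvar w) B
    split-in-B (inj₁ refl) = x-in-B
    split-in-B (inj₂ refl) = x-in-B

    source-shared : ∀ s → sideAt s ≡ fromA → StartsRun x s → Shared A B (dvar (srcAt s))
    source-shared s side-A start = proj₁ (encode-occurs (A-edge s side-A)) , in-B start
      where
      in-B : StartsRun x s → OccursIn (dvar (srcAt s)) B
      in-B (inj₁ side-B) = subst (λ w → OccursIn (dvar w) B) (tgtAt-pred s)
                             (proj₂ (encode-occurs (B-edge (s + n) side-B)))
      in-B (inj₂ split)  = split-in-B split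

    target-shared : ∀ s l → sideAt (s + l) ≡ fromA → sideAt (s + suc l) ≡ fromB ⊎ IsSplit x (tgtAt (s + l)) →
                    Shared A B (dvar (tgtAt (s + l)))
    target-shared s l side-A end = proj₂ (encode-occurs (A-edge (s + l) side-A)) , in-B end
      where
      in-B : sideAt (s + suc l) ≡ fromB ⊎ IsSplit x (tgtAt (s + l)) → OccursIn (dvar (tgtAt (s + l))) B
      in-B (inj₁ side-B) = subst (λ w → OccursIn (dvar w) B) (sym (tgtAt≡srcAt-next s l))
                             (proj₁ (encode-occurs (B-edge (s + suc l) side-B)))
      in-B (inj₂ split)  = split-in-B split

    shared : ∀ g → Iconj x g → ∀ y → OccursG y g → Shared A B y
    shared _ (s , l , (run , _ , end , _) , refl) y (inj₁ tgt≡y) =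
      subst (Shared A B) tgt≡y (target-shared s l (run l ℕP.≤-refl) end)
    shared _ (s , l , (run , start , _ , _) , refl) y (inj₂ src≡y) =
      subst (Shared A B) src≡y
        (source-shared s (subst (λ j → sideAt j ≡ fromA) (ℕP.+-identityʳ s) (run 0 z≤n)) start)

mainTheorem9 : (A B : List UTVPI) →
    SatℚList (A ++ B) →
    ¬ (∃[ ρ ] (All (satUℤ ρ) A × All (satUℤ ρ) B)) →
    (n : ℕ) (C : Fin (suc n) → LEdge) →
    (∀ j → InGraph (encode A) (encode B) (C j)) →
    CycleOps.IsClosedWalk C →
    CycleOps.totalWeight C ≡ + 0 →
    (x : Var) (p : Fin (suc n)) (ℓ : ℕ) → ℓ ≤ n →
    CycleOps.OccursOnceAt C (x ⁻) p →
    CycleOps.OccursOnceAt C (x ⁺) ((toℕ p + ℓ) mod suc n) →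
    Odd (CycleOps.pathWeight C (toℕ p) ℓ) →
    OccursIn x A → OccursIn x B →
    IsInterpolantℤ A B (CycleOps.Iconj C x)
mainTheorem9 A B _ _ n C in-graph closed total≡0 x p ℓ ℓ≤n occ⁻ occ⁺ odd _ x-in-B =
    implied-by-A
  , inconsistent-with-B total≡0 p ℓ ℓ≤n occ⁻ occ⁺ odd
  , shared x-in-B
  where open Interpolation A B C in-graph closed x
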